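{- Let $Q = v_1, e_1, \ldots, e_{s-1}, v_s$ be a path in a graph. Let $F \subseteq E(Q)$ with $f = |F|$. Let $A$ and $B$ be subsets of $\{v_1, \ldots, v_s\}$ that are vertex-disjoint from all edges in $F$ (i.e., no vertex of $A \cup B$ is an endpoint of an edge of $F$), and such that for each $v_i \in A$ and $v_j \in B$, either $i = j$ or $|i - j| \geq 2$. Then: (i) if $A = B$, then $s \geq |A| + |B| + f - 1$; (ii) if $B \neq A$, then $s \geq |A| + |B| + f$, with equality only if $A \subset B$ or $B \subset A$. -}

module Defs where

open import Data.Nat using (ℕ; suc; _+_; _∸_; _≤_)
open import Data.Fin using (Fin; toℕ)
open import Data.Fin.Subset using (Subset; _∈_)
open import Data.Product using (_×_)
open import Data.Sum using (_⊎_)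
open import Relation.Binary.PropositionalEquality using (_≡_; _≢_)

-- The path Q = v_1, e_1, ..., e_{s-1}, v_s is represented by its indices
-- (0-based): vertex i : Fin s stands for v_{i+1}, and edge k : Fin (s ∸ 1)
-- stands for e_{k+1}, whose endpoints are the vertices with indices
-- toℕ k and toℕ k + 1.  Subsets of V(Q) are Subset s, subsets of E(Q)
-- are Subset (s ∸ 1).

IsEndpoint : {s : ℕ} → Fin s → Fin (s ∸ 1) → Set
IsEndpoint i k = (toℕ i ≡ toℕ k) ⊎ (toℕ i ≡ suc (toℕ k))

AvoidsEdges : {s : ℕ} → Subset (s ∸ 1) → Subset s → Set
AvoidsEdges {s} F X = (i : Fin s) → i ∈ X → (k : Fin (s ∸ 1)) → k ∈ F → ¬E i k
  where
  open import Relation.Nullary using (¬_)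
  ¬E : Fin s → Fin (s ∸ 1) → Set
  ¬E i k = ¬ IsEndpoint i k

Separated : {s : ℕ} → Subset s → Subset s → Set
Separated {s} A B = (i j : Fin s) → i ∈ A → j ∈ B →
  (i ≡ j) ⊎ ((2 + toℕ i ≤ toℕ j) ⊎ (2 + toℕ j ≤ toℕ i))

-- Read the path from its first vertex and charge every vertex and edge.  The
-- weight ∣A∣ + ∣B∣ + ∣F∣ + [A ⊈ B] + [B ⊈ A], where [A ⊈ B] is 1 if A ⊈ B and
-- 0 otherwise, is at most s + 1, and at most s when the first vertex lies in
-- neither set.  An edge of F joins two free vertices; a vertex of A ∩ B has
-- free neighbours and no incident edge in F, so the free vertex after it pays
-- for it; a vertex of A ∖ B is followed either by a free vertex or by another
-- vertex of A ∖ B, and in the latter case [A ⊈ B] is already paid by the rest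
-- of the path.  If A ≠ B one indicator is 1, and equality s = ∣A∣ + ∣B∣ + ∣F∣
-- leaves room for only one of them, which is strict inclusion.
module Submission where

open import Defs
open import Data.Nat using (ℕ; zero; suc; _+_; _∸_; _≤_; _<_; z≤n; s≤s; s≤s⁻¹)
open import Data.Nat.Properties
  using (≤-refl; ≤-trans; ≤-reflexive; +-suc; +-comm; +-monoʳ-≤; +-cancelʳ-≤;
         m≤m+n; m≤n+m; m≤n⇒m≤1+n; <⇒≤; <⇒≢; module ≤-Reasoning)
open import Data.Fin using (zero; suc)
open import Data.Fin.Properties using (suc-injective)
open import Data.Fin.Subset using (Subset; inside; outside; ∣_∣; _∈_; _∉_; _⊈_; _⊂_)
open import Data.Fin.Subset.Properties using (_⊆?_; ⊆-antisym; out⊆; in⊆in; drop-there)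
open import Data.Vec using ([]; _∷_; here; there)
open import Data.Bool using (if_then_else_)
open import Data.Empty using (⊥-elim)
open import Data.Product using (_×_; _,_; ∃)
open import Data.Sum using (_⊎_; inj₁; inj₂)
open import Function using (_∘_)
open import Relation.Nullary using (¬_; does; yes; no)
open import Relation.Binary.PropositionalEquality using (_≡_; _≢_; refl; cong; cong₂; subst; sym)

[_⊈_] : ∀ {n} → Subset n → Subset n → ℕ
[ p ⊈ q ] = if does (p ⊆? q) then 0 else 1

∃∈∉-there : ∀ {n} {p q : Subset n} {s t} →
  ∃ (λ x → x ∈ p × x ∉ q) → ∃ λ x → x ∈ s ∷ p × x ∉ t ∷ q
∃∈∉-there (x , x∈p , x∉q) = suc x , there x∈p , x∉q ∘ drop-there

⊈⇒∃∈∉ : ∀ {n} {p q : Subset n} → p ⊈ q → ∃ λ x → x ∈ p × x ∉ q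
⊈⇒∃∈∉ {p = []}          {[]}          p⊈q = ⊥-elim (p⊈q λ ())
⊈⇒∃∈∉ {p = inside ∷ p}  {outside ∷ q} _   = zero , here , λ ()
⊈⇒∃∈∉ {p = inside ∷ p}  {inside ∷ q}  p⊈q = ∃∈∉-there (⊈⇒∃∈∉ (p⊈q ∘ in⊆in))
⊈⇒∃∈∉ {p = outside ∷ p} {s ∷ q}       p⊈q = ∃∈∉-there (⊈⇒∃∈∉ (p⊈q ∘ out⊆))

weight : ∀ {m n} → Subset m → Subset n → Subset n → ℕ
weight F A B = ∣ A ∣ + ∣ B ∣ + ∣ F ∣ + ([ A ⊈ B ] + [ B ⊈ A ])

weight-sym : ∀ {m n} (F : Subset m) (A B : Subset n) → weight F A B ≡ weight F B A
weight-sym F A B = cong₂ _+_ (cong (_+ ∣ F ∣) (+-comm ∣ A ∣ ∣ B ∣)) (+-comm [ A ⊈ B ] [ B ⊈ A ])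

separated-sym : ∀ {s} {A B : Subset s} → Separated A B → Separated B A
separated-sym sep i j i∈B j∈A with sep j i j∈A i∈B
... | inj₁ j≡i        = inj₁ (sym j≡i)
... | inj₂ (inj₁ j<i) = inj₂ (inj₂ j<i)
... | inj₂ (inj₂ i<j) = inj₂ (inj₁ i<j)

separated-tail : ∀ {m a b} {A B : Subset m} → Separated (a ∷ A) (b ∷ B) → Separated A B
separated-tail sep i j i∈A j∈B with sep (suc i) (suc j) (there i∈A) (there j∈B)
... | inj₁ i≡j        = inj₁ (suc-injective i≡j)
... | inj₂ (inj₁ i<j) = inj₂ (inj₁ (s≤s⁻¹ i<j))
... | inj₂ (inj₂ j<i) = inj₂ (inj₂ (s≤s⁻¹ j<i))

avoidsEdges-tail : ∀ {m f a} {F : Subset m} {A : Subset (suc m)} →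
  AvoidsEdges {suc (suc m)} (f ∷ F) (a ∷ A) → AvoidsEdges F A
avoidsEdges-tail av i i∈A k k∈F (inj₁ i≡k)   = av (suc i) (there i∈A) (suc k) (there k∈F) (inj₁ (cong suc i≡k))
avoidsEdges-tail av i i∈A k k∈F (inj₂ i≡1+k) = av (suc i) (there i∈A) (suc k) (there k∈F) (inj₂ (cong suc i≡1+k))

¬avoids-first-edge-start : ∀ {m} {F : Subset m} {A : Subset (suc m)} →
  ¬ AvoidsEdges {suc (suc m)} (inside ∷ F) (inside ∷ A)
¬avoids-first-edge-start av = av zero here zero here (inj₁ refl)

¬avoids-first-edge-end : ∀ {m a} {F : Subset m} {A : Subset m} →
  ¬ AvoidsEdges {suc (suc m)} (inside ∷ F) (a ∷ inside ∷ A)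
¬avoids-first-edge-end av = av (suc zero) (there here) zero here (inj₂ refl)

¬separated-adjacent : ∀ {m a b} {A B : Subset m} → ¬ Separated (inside ∷ a ∷ A) (b ∷ inside ∷ B)
¬separated-adjacent sep with sep zero (suc zero) here (there here)
... | inj₁ ()
... | inj₂ (inj₁ (s≤s ()))
... | inj₂ (inj₂ ())

free-head-bound : ∀ m (F : Subset m) (A B : Subset m) →
  AvoidsEdges F (outside ∷ A) → AvoidsEdges F (outside ∷ B) → Separated (outside ∷ A) (outside ∷ B) →
  weight F (outside ∷ A) (outside ∷ B) ≤ suc m

pure-head-bound : ∀ m (F : Subset m) (A B : Subset m) →
  AvoidsEdges F (inside ∷ A) → AvoidsEdges F (outside ∷ B) → Separated (inside ∷ A) (outside ∷ B) →
  weight F (inside ∷ A) (outside ∷ B) ≤ suc (suc m)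

shared-head-bound : ∀ m (F : Subset m) (A B : Subset m) →
  AvoidsEdges F (inside ∷ A) → AvoidsEdges F (inside ∷ B) → Separated (inside ∷ A) (inside ∷ B) →
  weight F (inside ∷ A) (inside ∷ B) ≤ suc (suc m)

weight-bound : ∀ m (F : Subset m) (A B : Subset (suc m)) →
  AvoidsEdges F A → AvoidsEdges F B → Separated A B → weight F A B ≤ suc (suc m)

free-head-bound zero [] [] [] _ _ _ = z≤n
free-head-bound (suc m) (outside ∷ F) A B avA avB sep =
  weight-bound m F A B (avoidsEdges-tail avA) (avoidsEdges-tail avB) (separated-tail sep)
free-head-bound (suc m) (inside ∷ F) (inside ∷ A) B avA _ _ = ⊥-elim (¬avoids-first-edge-end avA)
free-head-bound (suc m) (inside ∷ F) A (inside ∷ B) _ avB _ = ⊥-elim (¬avoids-first-edge-end avB)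
free-head-bound (suc m) (inside ∷ F) (outside ∷ A) (outside ∷ B) avA avB sep =
  subst (_≤ suc (suc m)) (sym (cong (_+ ([ A ⊈ B ] + [ B ⊈ A ])) (+-suc (∣ A ∣ + ∣ B ∣) ∣ F ∣)))
    (s≤s (free-head-bound m F A B (avoidsEdges-tail avA) (avoidsEdges-tail avB) (separated-tail sep)))

pure-head-bound zero [] [] [] _ _ _ = ≤-refl
pure-head-bound (suc m) (inside ∷ F) A B avA _ _ = ⊥-elim (¬avoids-first-edge-start avA)
pure-head-bound (suc m) F (a ∷ A) (inside ∷ B) _ _ sep = ⊥-elim (¬separated-adjacent sep)
pure-head-bound (suc m) (outside ∷ F) (inside ∷ A) (outside ∷ B) avA avB sep =
  s≤s (pure-head-bound m F A B (avoidsEdges-tail avA) (avoidsEdges-tail avB) (separated-tail sep))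
pure-head-bound (suc m) (outside ∷ F) (outside ∷ A) (outside ∷ B) avA avB sep =
  s≤s (begin
    ∣ A ∣ + ∣ B ∣ + ∣ F ∣ + suc [ B ⊈ A ]           ≡⟨ +-suc (∣ A ∣ + ∣ B ∣ + ∣ F ∣) [ B ⊈ A ] ⟩
    suc (∣ A ∣ + ∣ B ∣ + ∣ F ∣ + [ B ⊈ A ])         ≤⟨ s≤s (+-monoʳ-≤ (∣ A ∣ + ∣ B ∣ + ∣ F ∣) (m≤n+m [ B ⊈ A ] [ A ⊈ B ])) ⟩
    suc (weight F (outside ∷ A) (outside ∷ B))     ≤⟨ s≤s (free-head-bound m F A B (avoidsEdges-tail avA) (avoidsEdges-tail avB) (separated-tail sep)) ⟩
    suc (suc m)                                    ∎)
  where open ≤-Reasoning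

shared-head-bound zero [] [] [] _ _ _ = ≤-refl
shared-head-bound (suc m) (inside ∷ F) A B avA _ _ = ⊥-elim (¬avoids-first-edge-start avA)
shared-head-bound (suc m) F (a ∷ A) (inside ∷ B) _ _ sep = ⊥-elim (¬separated-adjacent sep)
shared-head-bound (suc m) F (inside ∷ A) (b ∷ B) _ _ sep = ⊥-elim (¬separated-adjacent (separated-sym sep))
shared-head-bound (suc m) (outside ∷ F) (outside ∷ A) (outside ∷ B) avA avB sep =
  s≤s (begin
    ∣ A ∣ + suc ∣ B ∣ + ∣ F ∣ + ([ A ⊈ B ] + [ B ⊈ A ]) ≡⟨ cong (λ t → t + ∣ F ∣ + ([ A ⊈ B ] + [ B ⊈ A ])) (+-suc ∣ A ∣ ∣ B ∣) ⟩
    suc (weight F (outside ∷ A) (outside ∷ B))           ≤⟨ s≤s (free-head-bound m F A B (avoidsEdges-tail avA) (avoidsEdges-tail avB) (separated-tail sep)) ⟩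
    suc (suc m)                                          ∎)
  where open ≤-Reasoning

weight-bound m F (outside ∷ A) (outside ∷ B) avA avB sep = m≤n⇒m≤1+n (free-head-bound m F A B avA avB sep)
weight-bound m F (inside ∷ A)  (outside ∷ B) avA avB sep = pure-head-bound m F A B avA avB sep
weight-bound m F (outside ∷ A) (inside ∷ B)  avA avB sep =
  subst (_≤ suc (suc m)) (weight-sym F (inside ∷ B) (outside ∷ A))
    (pure-head-bound m F B A avB avA (separated-sym sep))
weight-bound m F (inside ∷ A)  (inside ∷ B)  avA avB sep = shared-head-bound m F A B avA avB sep

path-bound : ∀ s (F : Subset (s ∸ 1)) (A B : Subset s) →
  AvoidsEdges F A → AvoidsEdges F B → Separated A B → weight F A B ≤ s + 1
path-bound zero    [] [] [] _   _   _   = z≤n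
path-bound (suc m) F  A  B  avA avB sep = ≤-trans (weight-bound m F A B avA avB sep) (≤-reflexive (+-comm 1 (suc m)))

bound-for-distinct : ∀ {n S s} (A B : Subset n) → A ≢ B → S + ([ A ⊈ B ] + [ B ⊈ A ]) ≤ s + 1 →
  (S ≤ s) × (S ≡ s → (A ⊂ B) ⊎ (B ⊂ A))
bound-for-distinct A B A≢B bound with A ⊆? B | B ⊆? A
... | yes A⊆B | yes B⊆A = ⊥-elim (A≢B (⊆-antisym A⊆B B⊆A))
... | yes A⊆B | no  B⊈A = +-cancelʳ-≤ 1 _ _ bound , λ _ → inj₁ (A⊆B , ⊈⇒∃∈∉ B⊈A)
... | no  A⊈B | yes B⊆A = +-cancelʳ-≤ 1 _ _ bound , λ _ → inj₂ (B⊆A , ⊈⇒∃∈∉ A⊈B)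
bound-for-distinct {S = S} {s} A B A≢B bound | no _ | no _ = <⇒≤ S<s , λ S≡s → ⊥-elim (<⇒≢ S<s S≡s)
  where
  S<s : S < s
  S<s = +-cancelʳ-≤ 1 (suc S) s (subst (_≤ s + 1) (+-suc S 1) bound)

lemma5 : (s : ℕ) (F : Subset (s ∸ 1)) (A B : Subset s) →
    AvoidsEdges F A → AvoidsEdges F B → Separated A B →
    (A ≡ B → ∣ A ∣ + ∣ B ∣ + ∣ F ∣ ≤ s + 1) ×
    (A ≢ B → (∣ A ∣ + ∣ B ∣ + ∣ F ∣ ≤ s) ×
             (∣ A ∣ + ∣ B ∣ + ∣ F ∣ ≡ s → (A ⊂ B) ⊎ (B ⊂ A)))
lemma5 s F A B avA avB sep =
  (λ _ → ≤-trans (m≤m+n _ _) bound) , λ A≢B → bound-for-distinct A B A≢B bound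
  where
  bound : weight F A B ≤ s + 1
  bound = path-bound s F A B avA avB sep
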